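{- Let $\mathscr B$ be a base, $P=[p_1,\dots,p_n]$ and $S$ finite multisets of atoms, and $q$ an atom. Then the following are equivalent: (1) $P,S\vdash_{\mathscr B}q$; (2) for every base $\mathscr X\supseteq\mathscr B$ and all finite multisets of atoms $T_1,\dots,T_n$, if $T_i\vdash_{\mathscr X}p_i$ for all $i=1,\dots,n$, then $T_1,\dots,T_n,S\vdash_{\mathscr X}q$.
   Context: Fix a countably infinite set $\mathbb{A}$ of atoms. $P,S,T$ denote finite multisets of atoms and "$P,S$" multiset union. An atomic rule is $(P_1\triangleright p_1,\dots,P_n\triangleright p_n)\Rightarrow p$ ($n\ge0$, $P_i$ finite multisets of atoms, $p_i,p$ atoms). A base is a (possibly infinite) set of atomic rules; $\mathscr X\supseteq\mathscr B$ means extension. Derivability $P\vdash_{\mathscr B}q$ is the least relation with: $[p]\vdash_{\mathscr B}p$ for every atom $p$; if $(P_1\triangleright p_1,\dots,P_n\triangleright p_n)\Rightarrow p\in\mathscr B$ and $S_i,P_i\vdash_{\mathscr B}p_i$ for $i=1,\dots,n$, then $S_1,\dots,S_n\vdash_{\mathscr B}p$. -}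

module Defs where

open import Data.Nat using (ℕ)
open import Data.List using (List; []; _∷_; _++_; concat; [_])
open import Data.Product using (_×_; _,_)
open import Data.List.Relation.Binary.Permutation.Propositional using (_↭_)

Atom : Set
Atom = ℕ

-- Finite multisets of atoms are represented by lists, considered up to
-- permutation (_↭_); all notions below are invariant under permutation.
MSet : Set
MSet = List Atom

record Rule : Set where
  constructor _⇒_
  field
    premises   : List (MSet × Atom)
    conclusion : Atom

Base : Set₁
Base = Rule → Set

_⊇_ : Base → Base → Set
X ⊇ B = ∀ r → B r → X r

mutual
  data _⊢[_]_ : MSet → Base → Atom → Set₁ where
    ax   : ∀ {B Γ p} → Γ ↭ [ p ] → Γ ⊢[ B ] p
    rule : ∀ {B Γ} prems p → B (prems ⇒ p) → (Ss : List MSet) →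
           Premises B Ss prems → Γ ↭ concat Ss → Γ ⊢[ B ] p

  data Premises (B : Base) : List MSet → List (MSet × Atom) → Set₁ where
    []  : Premises B [] []
    _∷_ : ∀ {S P p Ss prems} → (S ++ P) ⊢[ B ] p → Premises B Ss prems →
          Premises B (S ∷ Ss) ((P , p) ∷ prems)

data AllDerive (X : Base) : List MSet → List Atom → Set₁ where
  []  : AllDerive X [] []
  _∷_ : ∀ {T p Ts ps} → T ⊢[ X ] p → AllDerive X Ts ps →
        AllDerive X (T ∷ Ts) (p ∷ ps)

-- (1) ⇒ (2): derivability is monotone in the base, and cut is admissible:
-- a derivation of p can replace one occurrence of the hypothesis p by pushing
-- it up into the premise whose context contains that occurrence, down to the
-- axiom [p] ⊢ p.  Cutting p₁, …, pₙ one after another gives (2).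
-- (2) ⇒ (1): take 𝒳 = ℬ and Tᵢ = [pᵢ], derived by the axiom.
module Submission where

open import Defs
open import Data.List using (List; []; _∷_; _++_; concat; [_]; map)
open import Data.List.Properties using (++-assoc; ++-identityʳ)
open import Data.List.Membership.Propositional using (_∈_)
open import Data.List.Membership.Propositional.Properties using (∈-++⁻; ∈-∃++)
open import Data.List.Relation.Unary.Any using (here)
open import Data.List.Relation.Binary.Permutation.Propositional
  using (_↭_; ↭-refl; ↭-sym; ↭-trans; ↭-reflexive)
open import Data.List.Relation.Binary.Permutation.Propositional.Properties
  using (↭-singleton-inv; ↭-empty-inv; ∈-resp-↭; ++⁺ˡ; ++⁺ʳ; ++-comm; shift; shifts; drop-∷)
open import Data.Product using (_×_; _,_; ∃)
open import Data.Sum using (inj₁; inj₂)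
open import Function.Bundles using (_⇔_; mk⇔)
open import Relation.Binary.PropositionalEquality using (_≡_; refl; sym; cong; subst)

∈⇒↭-∷ : {p : Atom} {xs : List Atom} → p ∈ xs → ∃ λ ys → xs ↭ p ∷ ys
∈⇒↭-∷ {p} p∈xs with ys , zs , refl ← ∈-∃++ p∈xs = ys ++ zs , shift p ys zs

⊢-resp-↭ : ∀ {B Γ Γ′ q} → Γ ⊢[ B ] q → Γ ↭ Γ′ → Γ′ ⊢[ B ] q
⊢-resp-↭ (ax Γ↭[p])                  e = ax (↭-trans (↭-sym e) Γ↭[p])
⊢-resp-↭ (rule prems p r Ss ds Γ↭Ss) e = rule prems p r Ss ds (↭-trans (↭-sym e) Γ↭Ss)

mutual
  ⊢-mono : ∀ {B X Γ q} → X ⊇ B → Γ ⊢[ B ] q → Γ ⊢[ X ] q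
  ⊢-mono X⊇B (ax Γ↭[p])                  = ax Γ↭[p]
  ⊢-mono X⊇B (rule prems p r Ss ds Γ↭Ss) =
    rule prems p (X⊇B _ r) Ss (Premises-mono X⊇B ds) Γ↭Ss

  Premises-mono : ∀ {B X Ss prems} → X ⊇ B → Premises B Ss prems → Premises X Ss prems
  Premises-mono X⊇B []       = []
  Premises-mono X⊇B (d ∷ ds) = ⊢-mono X⊇B d ∷ Premises-mono X⊇B ds

mutual
  ⊢-cut : ∀ {B Γ Δ T p q} → Γ ⊢[ B ] q → Γ ↭ p ∷ Δ → T ⊢[ B ] p → (T ++ Δ) ⊢[ B ] q
  ⊢-cut {T = T} (ax Γ↭[q]) Γ↭p∷Δ dT
    with refl ← ↭-singleton-inv (↭-trans (↭-sym Γ↭p∷Δ) Γ↭[q]) =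
    ⊢-resp-↭ dT (↭-reflexive (sym (++-identityʳ T)))
  ⊢-cut (rule prems p r Ss ds Γ↭Ss) Γ↭p∷Δ dT
    with Ss′ , ds′ , T++Δ↭Ss′ ← Premises-cut ds (↭-trans (↭-sym Γ↭Ss) Γ↭p∷Δ) dT =
    rule prems p r Ss′ ds′ T++Δ↭Ss′

  Premises-cut : ∀ {B Ss prems Δ T p} → Premises B Ss prems → concat Ss ↭ p ∷ Δ →
    T ⊢[ B ] p → ∃ λ Ss′ → Premises B Ss′ prems × (T ++ Δ) ↭ concat Ss′
  Premises-cut [] e dT with () ← ↭-empty-inv (↭-sym e)
  Premises-cut {Δ = Δ} {T} {p} (_∷_ {S} {P} {Ss = Ss} dS ds) e dT
    with ∈-++⁻ S (∈-resp-↭ (↭-sym e) (here refl))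
  ... | inj₁ p∈S with S₀ , S↭p∷S₀ ← ∈⇒↭-∷ p∈S =
    (T ++ S₀) ∷ Ss ,
    ⊢-resp-↭ (⊢-cut dS (++⁺ʳ P S↭p∷S₀) dT) (↭-reflexive (sym (++-assoc T S₀ P))) ∷ ds ,
    ↭-trans (++⁺ˡ T (↭-sym S₀++R↭Δ)) (↭-reflexive (sym (++-assoc T S₀ (concat Ss))))
    where
    S₀++R↭Δ : S₀ ++ concat Ss ↭ Δ
    S₀++R↭Δ = drop-∷ (↭-trans (++⁺ʳ (concat Ss) (↭-sym S↭p∷S₀)) e)
  ... | inj₂ p∈R with R₀ , R↭p∷R₀ ← ∈⇒↭-∷ p∈R
    with Ss′ , ds′ , T++R₀↭Ss′ ← Premises-cut ds R↭p∷R₀ dT =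
    S ∷ Ss′ , dS ∷ ds′ ,
    ↭-trans (++⁺ˡ T (↭-sym S++R₀↭Δ)) (↭-trans (shifts T S) (++⁺ˡ S T++R₀↭Ss′))
    where
    S++R₀↭Δ : S ++ R₀ ↭ Δ
    S++R₀↭Δ = drop-∷ (↭-trans (↭-sym (shift p S R₀)) (↭-trans (++⁺ˡ S (↭-sym R↭p∷R₀)) e))

⊢-multicut : ∀ {X} P S {q} (Ts : List MSet) →
  (P ++ S) ⊢[ X ] q → AllDerive X Ts P → (concat Ts ++ S) ⊢[ X ] q
⊢-multicut []      S []       d []         = d
⊢-multicut (p ∷ P) S (T ∷ Ts) d (dT ∷ dTs) =
  ⊢-resp-↭ (⊢-multicut P (S ++ T) Ts (⊢-resp-↭ (⊢-cut d ↭-refl dT) T-to-back) dTs) T-to-front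
  where
  T-to-back : T ++ P ++ S ↭ P ++ S ++ T
  T-to-back = ↭-trans (++-comm T (P ++ S)) (↭-reflexive (++-assoc P S T))

  T-to-front : concat Ts ++ S ++ T ↭ (T ++ concat Ts) ++ S
  T-to-front = ↭-trans (↭-reflexive (sym (++-assoc (concat Ts) S T)))
    (↭-trans (++-comm (concat Ts ++ S) T) (↭-reflexive (sym (++-assoc T (concat Ts) S))))

concat-map-[_] : (P : MSet) → concat (map [_] P) ≡ P
concat-map-[ [] ]    = refl
concat-map-[ p ∷ P ] = cong (p ∷_) concat-map-[ P ]

AllDerive-axioms : ∀ {X} (P : MSet) → AllDerive X (map [_] P) P
AllDerive-axioms []      = []
AllDerive-axioms (p ∷ P) = ax ↭-refl ∷ AllDerive-axioms P

proposition2 : (B : Base) (P S : MSet) (q : Atom) →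
    ((P ++ S) ⊢[ B ] q) ⇔ ((X : Base) → X ⊇ B → (Ts : List MSet) →
    AllDerive X Ts P → (concat Ts ++ S) ⊢[ X ] q)
proposition2 B P S q = mk⇔
  (λ d X X⊇B Ts dTs → ⊢-multicut P S Ts (⊢-mono X⊇B d) dTs)
  (λ sound → subst (λ Γ → (Γ ++ S) ⊢[ B ] q) (concat-map-[ P ])
                   (sound B (λ _ r → r) (map [_] P) (AllDerive-axioms P)))
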